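{- Let $G$ be a connected graph, let $R$ be a general position set of $G$, and let $v\in R$. Then $|R|\le \mathrm{ip}(v,G)+1$. In particular, if $v$ is a gp-vertex of $G$, then $\mathrm{gp}(G)\le \mathrm{ip}(v,G)+1$.
   Context: For a connected graph $G$, a set $S\subseteq V(G)$ is a general position set if no three distinct vertices of $S$ lie on a common geodesic (shortest path) of $G$; $\mathrm{gp}(G)$ is the maximum cardinality of a general position set, and a general position set of that cardinality is a gp-set. A vertex is a gp-vertex if it lies in at least one gp-set. For $v\in V(G)$, $\mathrm{ip}(v,G)$ is the minimum number of geodesics of $G$, all having $v$ as an end-vertex, whose vertex sets cover $V(G)$. -}

module Defs where

open import Data.Nat using (ℕ; zero; suc; _≤_)
open import Data.Fin using (Fin)
open import Data.Fin.Subset using (Subset; _∈_; ∣_∣)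
open import Data.List using (List; []; _∷_)
import Data.List.Membership.Propositional as LM
open import Data.Product using (Σ; ∃; _×_; _,_)
open import Data.Sum using (_⊎_)
open import Relation.Binary.PropositionalEquality using (_≡_)
open import Relation.Nullary using (¬_)

record Graph (n : ℕ) : Set₁ where
  field
    Adj     : Fin n → Fin n → Set
    symmetric   : ∀ {x y} → Adj x y → Adj y x
    irreflexive : ∀ {x} → ¬ Adj x x

module _ {n : ℕ} (G : Graph n) where
  open Graph G

  data Walk : Fin n → Fin n → ℕ → Set where
    [] : ∀ {u} → Walk u u 0
    _∷_ : ∀ {u w v k} → Adj u w → Walk w v k → Walk u v (suc k)

  vertices : ∀ {u v k} → Walk u v k → List (Fin n)
  vertices {u} [] = u ∷ []
  vertices {u} (_ ∷ p) = u ∷ vertices p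

  OnWalk : ∀ {u v k} → Fin n → Walk u v k → Set
  OnWalk x p = x LM.∈ vertices p

  Connected : Set
  Connected = ∀ u v → ∃ λ k → Walk u v k

  IsGeodesic : ∀ {u v k} → Walk u v k → Set
  IsGeodesic {u} {v} {k} _ = ∀ m → Walk u v m → k ≤ m

  record Geodesic : Set where
    constructor geo
    field
      start end : Fin n
      len   : ℕ
      path  : Walk start end len
      isGeo : IsGeodesic path

  OnGeodesic : Fin n → Geodesic → Set
  OnGeodesic x g = OnWalk x (Geodesic.path g)

  GeneralPosition : Subset n → Set
  GeneralPosition S = ∀ x y z → x ∈ S → y ∈ S → z ∈ S →
    ¬ (x ≡ y) → ¬ (y ≡ z) → ¬ (x ≡ z) →
    ¬ (Σ Geodesic λ g → OnGeodesic x g × OnGeodesic y g × OnGeodesic z g)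

  IsGPSet : Subset n → Set
  IsGPSet S = GeneralPosition S × (∀ T → GeneralPosition T → ∣ T ∣ ≤ ∣ S ∣)

  IsGPNumber : ℕ → Set
  IsGPNumber g = Σ (Subset n) λ S → IsGPSet S × ∣ S ∣ ≡ g

  IsGPVertex : Fin n → Set
  IsGPVertex v = Σ (Subset n) λ S → IsGPSet S × v ∈ S

  IPCover : Fin n → ℕ → Set
  IPCover v k = Σ (Fin k → Geodesic) λ P →
    (∀ i → Geodesic.start (P i) ≡ v ⊎ Geodesic.end (P i) ≡ v) × (∀ x → ∃ λ i → OnGeodesic x (P i))

  IsIP : Fin n → ℕ → Set
  IsIP v k = IPCover v k × (∀ m → IPCover v m → k ≤ m)

module Submission where

open import Defs
open import Data.Nat using (ℕ; zero; suc; _≤_; _+_; z≤n; s≤s)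
open import Data.Nat.Properties using (≤-trans; +-comm)
open import Data.Fin using (Fin; punchOut) renaming (zero to fz; suc to fs)
open import Data.Fin.Properties using (punchOut-injective; suc-injective; _≟_)
open import Data.Fin.Subset using (Subset; _∈_; ∣_∣; inside; outside)
open import Data.Vec using ([]; _∷_; here; there)
open import Data.List.Relation.Unary.Any using (here; there)
open import Data.Product using (_×_; _,_; proj₁; proj₂; ∃)
open import Data.Sum using (_⊎_; inj₁; inj₂)
open import Data.Empty using (⊥-elim)
open import Function using (_∘_)
open import Relation.Binary.PropositionalEquality using (_≡_; _≢_; refl; sym; trans; subst)
open import Relation.Nullary using (Dec; yes; no)

-- Every vertex of R other than v lies on one of the k geodesics of a
-- cover of V(G), and all of them pass through v ∈ R; by general position no geodesic
-- through v carries two further vertices of R. Hence x ↦ (geodesic covering x)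
-- is injective on R ∖ {v}, and |R| ≤ k + 1. The gp-vertex statement follows by
-- applying this to a gp-set containing v.

∣S∣≤-by-injection : ∀ {n k} (S : Subset n) (f : ∀ x → x ∈ S → Fin k) →
  (∀ {x y} (x∈S : x ∈ S) (y∈S : y ∈ S) → f x x∈S ≡ f y y∈S → x ≡ y) →
  ∣ S ∣ ≤ k
∣S∣≤-by-injection [] f f-inj = z≤n
∣S∣≤-by-injection (outside ∷ S) f f-inj =
  ∣S∣≤-by-injection S (λ x → f (fs x) ∘ there) (λ x∈S y∈S → suc-injective ∘ f-inj (there x∈S) (there y∈S))
∣S∣≤-by-injection {k = zero} (inside ∷ S) f f-inj with f fz here
... | ()
∣S∣≤-by-injection {k = suc k} (inside ∷ S) f f-inj = s≤s (∣S∣≤-by-injection S f′ f′-inj)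
  where
  f₀≢f : ∀ {x} (x∈S : x ∈ S) → f fz here ≢ f (fs x) (there x∈S)
  f₀≢f x∈S eq with f-inj here (there x∈S) eq
  ... | ()

  f′ : ∀ x → x ∈ S → Fin k
  f′ x x∈S = punchOut (f₀≢f x∈S)

  f′-inj : ∀ {x y} (x∈S : x ∈ S) (y∈S : y ∈ S) → f′ x x∈S ≡ f′ y y∈S → x ≡ y
  f′-inj x∈S y∈S = suc-injective ∘ f-inj (there x∈S) (there y∈S) ∘ punchOut-injective (f₀≢f x∈S) (f₀≢f y∈S)

module _ {n : ℕ} (G : Graph n) where

  start-onWalk : ∀ {u v k} (p : Walk G u v k) → OnWalk G u p
  start-onWalk []      = here refl
  start-onWalk (_ ∷ _) = here refl

  end-onWalk : ∀ {u v k} (p : Walk G u v k) → OnWalk G v p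
  end-onWalk []      = here refl
  end-onWalk (_ ∷ p) = there (end-onWalk p)

  endpoint-onGeodesic : ∀ {v} (g : Geodesic G) →
    Geodesic.start g ≡ v ⊎ Geodesic.end g ≡ v → OnGeodesic G v g
  endpoint-onGeodesic g (inj₁ refl) = start-onWalk (Geodesic.path g)
  endpoint-onGeodesic g (inj₂ refl) = end-onWalk (Geodesic.path g)

  generalPosition-unique-onGeodesic : ∀ {R v x y} (g : Geodesic G) →
    GeneralPosition G R → v ∈ R → x ∈ R → y ∈ R → x ≢ v → y ≢ v →
    OnGeodesic G v g → OnGeodesic G x g → OnGeodesic G y g → x ≡ y
  generalPosition-unique-onGeodesic {x = x} {y} g gp v∈R x∈R y∈R x≢v y≢v v∈g x∈g y∈g with x ≟ y
  ... | yes x≡y = x≡y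
  ... | no x≢y  = ⊥-elim (gp _ x y v∈R x∈R y∈R (x≢v ∘ sym) x≢y (y≢v ∘ sym) (g , v∈g , x∈g , y∈g))

  ∣R∣≤1+geodesics-through : ∀ {R v k} (P : Fin k → Geodesic G) →
    GeneralPosition G R → v ∈ R →
    (∀ i → OnGeodesic G v (P i)) → (∀ x → ∃ λ i → OnGeodesic G x (P i)) →
    ∣ R ∣ ≤ suc k
  ∣R∣≤1+geodesics-through {R} {v} {k} P gp v∈R v∈P cover =
    ∣S∣≤-by-injection R (λ x _ → slot x (x ≟ v)) (λ x∈R y∈R → slot-inj (_ ≟ v) (_ ≟ v) x∈R y∈R)
    where
    slot : ∀ x → Dec (x ≡ v) → Fin (suc k)
    slot x (yes _) = fz
    slot x (no _)  = fs (proj₁ (cover x))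

    slot-inj : ∀ {x y} (x≟v : Dec (x ≡ v)) (y≟v : Dec (y ≡ v)) → x ∈ R → y ∈ R →
      slot x x≟v ≡ slot y y≟v → x ≡ y
    slot-inj (yes x≡v) (yes y≡v) _ _ _ = trans x≡v (sym y≡v)
    slot-inj (yes _)   (no _)    _ _ ()
    slot-inj (no _)    (yes _)   _ _ ()
    slot-inj {x} {y} (no x≢v) (no y≢v) x∈R y∈R same-slot =
      generalPosition-unique-onGeodesic (P i) gp v∈R x∈R y∈R x≢v y≢v (v∈P i) (proj₂ (cover x)) y∈Pi
      where
      i = proj₁ (cover x)
      y∈Pi : OnGeodesic G y (P i)
      y∈Pi = subst (OnGeodesic G y ∘ P) (sym (suc-injective same-slot)) (proj₂ (cover y))

  ∣R∣≤1+ip : ∀ {R v k} → GeneralPosition G R → v ∈ R → IPCover G v k → ∣ R ∣ ≤ suc k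
  ∣R∣≤1+ip gp v∈R (P , ends , cover) =
    ∣R∣≤1+geodesics-through P gp v∈R (λ i → endpoint-onGeodesic (P i) (ends i)) cover

  gp≤1+ip : ∀ {v g k} → IsGPVertex G v → IsGPNumber G g → IPCover G v k → g ≤ suc k
  gp≤1+ip (S , (gpS , S-max) , v∈S) (T , (gpT , _) , refl) cover =
    ≤-trans (S-max T gpT) (∣R∣≤1+ip gpS v∈S cover)

theorem3p3 : ∀ {n} (G : Graph n) → Connected G →
    (∀ (R : Subset n) (v : Fin n) (k : ℕ) → GeneralPosition G R → v ∈ R →
       IsIP G v k → ∣ R ∣ ≤ k + 1)
    × (∀ (v : Fin n) (g k : ℕ) → IsGPVertex G v → IsGPNumber G g →
       IsIP G v k → g ≤ k + 1)
theorem3p3 G _ =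
  (λ R v k gp v∈R ip → subst (∣ R ∣ ≤_) (+-comm 1 k) (∣R∣≤1+ip G gp v∈R (proj₁ ip))) ,
  (λ v g k gpv gpn ip → subst (g ≤_) (+-comm 1 k) (gp≤1+ip G gpv gpn (proj₁ ip)))
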